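{- Let $n \ge 1$ and let $\mathcal{A}_n([i,i,i+1])$ be the integral relation algebra with $n$ symmetric diversity atoms $a_0,\ldots,a_{n-1}$ whose forbidden cycles are exactly those of the form $a_i a_i a_{i+1}$ (indices modulo $n$, cycles considered up to the usual cycle symmetries), all other diversity cycles being allowed. Let $\mathrm{Aut}(\mathcal{A}_n([i,i,i+1]))$ be the group of permutations $\pi$ of $\{0,\ldots,n-1\}$ such that for all $i,j,\ell$, the cycle $a_ia_ja_\ell$ is forbidden if and only if $a_{\pi(i)}a_{\pi(j)}a_{\pi(\ell)}$ is forbidden. Then $\mathrm{Aut}(\mathcal{A}_n([i,i,i+1])) \cong \mathbb{Z}/n\mathbb{Z}$.
   Context: A relation algebra is integral if its identity $1'$ is an atom. For atoms $x,y,z$ the cycle $xyz$ is forbidden if $x;y \cdot z = 0$ and allowed otherwise; for symmetric atoms a cycle depends only on the multiset $\{x,y,z\}$. A finite integral symmetric relation algebra is determined by its set of forbidden diversity cycles. In general $\mathcal{A}_n([i,i+j,i+\ell])$ denotes the integral relation algebra with $n$ symmetric diversity atoms $a_0,\dots,a_{n-1}$ whose forbidden cycles are exactly those of the form $a_ia_{i+j}a_{i+\ell}$, indices modulo $n$. -}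

module Defs where

open import Data.Nat using (ℕ; suc; NonZero; _+_)
open import Data.Nat.DivMod using (_mod_)
open import Data.Fin using (Fin; toℕ)
open import Data.Fin.Permutation using (Permutation′; _⟨$⟩ʳ_; _∘ₚ_)
open import Data.Product using (Σ; ∃; _×_; _,_; proj₁)
open import Data.Sum using (_⊎_)
open import Relation.Binary.PropositionalEquality using (_≡_)
open import Function.Bundles using (_⇔_)

sucMod : {n : ℕ} .{{_ : NonZero n}} → Fin n → Fin n
sucMod {n} i = suc (toℕ i) mod n

_+ₘ_ : {n : ℕ} .{{_ : NonZero n}} → Fin n → Fin n → Fin n
_+ₘ_ {n} a b = (toℕ a + toℕ b) mod n

-- The cycle a_x a_y a_z is forbidden in A_n([i,i,i+1]) iff, for some i,
-- the multiset {x,y,z} equals {i,i,i+1} (atoms symmetric, so cycles depend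
-- only on the multiset; all orderings listed).
Forbidden : {n : ℕ} .{{_ : NonZero n}} → Fin n → Fin n → Fin n → Set
Forbidden x y z = ∃ λ i →
    (x ≡ i × y ≡ i × z ≡ sucMod i)
  ⊎ (x ≡ i × y ≡ sucMod i × z ≡ i)
  ⊎ (x ≡ sucMod i × y ≡ i × z ≡ i)

Aut : (n : ℕ) .{{_ : NonZero n}} → Set
Aut n = Σ (Permutation′ n) λ π →
  ∀ (i j l : Fin n) → Forbidden i j l ⇔ Forbidden (π ⟨$⟩ʳ i) (π ⟨$⟩ʳ j) (π ⟨$⟩ʳ l)

_≈ᴬ_ : {n : ℕ} .{{_ : NonZero n}} → Aut n → Aut n → Set
_≈ᴬ_ {n} σ τ = ∀ (x : Fin n) → proj₁ σ ⟨$⟩ʳ x ≡ proj₁ τ ⟨$⟩ʳ x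

_∙ᴬ_ : {n : ℕ} .{{_ : NonZero n}} → Aut n → Aut n → Aut n
_∙ᴬ_ {n} (σ , pσ) (τ , pτ) = (τ ∘ₚ σ) , λ i j l → Function.Bundles.mk⇔
  (λ f → Function.Bundles.Equivalence.to (pσ _ _ _) (Function.Bundles.Equivalence.to (pτ i j l) f))
  (λ f → Function.Bundles.Equivalence.from (pτ i j l) (Function.Bundles.Equivalence.from (pσ _ _ _) f))

IsGroupIsoZn→Aut : (n : ℕ) .{{_ : NonZero n}} → (Fin n → Aut n) → Set
IsGroupIsoZn→Aut n φ =
    (∀ (a b : Fin n) → φ (a +ₘ b) ≈ᴬ (φ a ∙ᴬ φ b))
  × (∀ (a b : Fin n) → φ a ≈ᴬ φ b → a ≡ b)
  × (∀ (σ : Aut n) → ∃ λ a → φ a ≈ᴬ σ)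

-- An automorphism σ maps the forbidden cycle a_x a_x a_{x+1} to a forbidden
-- cycle with a repeated atom; the only such cycles are a_u a_u a_{u+1}, so
-- σ(x+1) = σ(x)+1. Hence σ commutes with every rotation x ↦ x+k, and is
-- itself the rotation by σ(0). Conversely every rotation commutes with the
-- successor, so it preserves the forbidden cycles, and a ↦ (rotation by a) is
-- an isomorphism ℤ/nℤ ≅ Aut.
module Submission where

open import Defs
open import Data.Nat using (ℕ; NonZero; zero; suc; _+_; _∸_; _%_; _≤_)
open import Data.Nat.Properties using (+-comm; +-assoc; +-identityʳ; m+[n∸m]≡n; m∸n+n≡m; <⇒≤)
open import Data.Nat.DivMod using (_mod_; %-distribˡ-+; m%n%n≡m%n; [m+n]%n≡m%n; m%n<n; m<n⇒m%n≡m)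
open import Data.Fin using (Fin; toℕ)
open import Data.Fin.Properties using (toℕ-fromℕ<; fromℕ<-toℕ; fromℕ<-cong; toℕ<n)
open import Data.Fin.Permutation using (permutation; _⟨$⟩ʳ_)
open import Data.Product using (∃; _,_; proj₁; proj₂)
open import Data.Sum using (inj₁; inj₂)
open import Relation.Binary.PropositionalEquality
open import Function.Bundles using (mk⇔; Equivalence)

module _ {n : ℕ} .{{_ : NonZero n}} where

  mod-cong : ∀ {m k} → m % n ≡ k % n → m mod n ≡ k mod n
  mod-cong eq = fromℕ<-cong _ _ eq _ _

  toℕ-mod : ∀ m → toℕ (m mod n) ≡ m % n
  toℕ-mod m = toℕ-fromℕ< (m%n<n m n)

  toℕ-mod-inverse : ∀ (x : Fin n) → toℕ x mod n ≡ x
  toℕ-mod-inverse x =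
    trans (fromℕ<-cong _ _ (m<n⇒m%n≡m (toℕ<n x)) _ (toℕ<n x)) (fromℕ<-toℕ x (toℕ<n x))

  [m%n+k]mod≡[m+k]mod : ∀ m k → (m % n + k) mod n ≡ (m + k) mod n
  [m%n+k]mod≡[m+k]mod m k = mod-cong (begin
      (m % n + k) % n          ≡⟨ %-distribˡ-+ (m % n) k n ⟩
      (m % n % n + k % n) % n  ≡⟨ cong (λ t → (t + k % n) % n) (m%n%n≡m%n m n) ⟩
      (m % n + k % n) % n      ≡⟨ %-distribˡ-+ m k n ⟨
      (m + k) % n              ∎)
    where open ≡-Reasoning

  origin : Fin n
  origin = 0 mod n

  shift : ℕ → Fin n → Fin n
  shift k x = (toℕ x + k) mod n

  shift-+ : ∀ j k x → shift k (shift j x) ≡ shift (j + k) x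
  shift-+ j k x = begin
      (toℕ ((toℕ x + j) mod n) + k) mod n ≡⟨ cong (λ t → (t + k) mod n) (toℕ-mod _) ⟩
      ((toℕ x + j) % n + k) mod n         ≡⟨ [m%n+k]mod≡[m+k]mod _ k ⟩
      (toℕ x + j + k) mod n               ≡⟨ cong (_mod n) (+-assoc (toℕ x) j k) ⟩
      (toℕ x + (j + k)) mod n             ∎
    where open ≡-Reasoning

  shift-% : ∀ k x → shift (k % n) x ≡ shift k x
  shift-% k x = begin
      (toℕ x + k % n) mod n ≡⟨ cong (_mod n) (+-comm (toℕ x) _) ⟩
      (k % n + toℕ x) mod n ≡⟨ [m%n+k]mod≡[m+k]mod k (toℕ x) ⟩
      (k + toℕ x) mod n     ≡⟨ cong (_mod n) (+-comm k _) ⟩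
      (toℕ x + k) mod n     ∎
    where open ≡-Reasoning

  shift-0 : ∀ x → shift 0 x ≡ x
  shift-0 x = trans (cong (_mod n) (+-identityʳ (toℕ x))) (toℕ-mod-inverse x)

  shift-n : ∀ x → shift n x ≡ x
  shift-n x = trans (mod-cong ([m+n]%n≡m%n (toℕ x) n)) (toℕ-mod-inverse x)

  shift-cancel : ∀ {j k} → j + k ≡ n → ∀ x → shift k (shift j x) ≡ x
  shift-cancel j+k≡n x = trans (shift-+ _ _ x) (trans (cong (λ t → shift t x) j+k≡n) (shift-n x))

  shift-comm : ∀ (x y : Fin n) → shift (toℕ y) x ≡ shift (toℕ x) y
  shift-comm x y = cong (_mod n) (+-comm (toℕ x) (toℕ y))

  shift-origin : ∀ k → shift k origin ≡ k mod n
  shift-origin k = trans (cong (λ t → (t + k) mod n) (toℕ-mod 0)) ([m%n+k]mod≡[m+k]mod 0 k)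

  shift-suc : ∀ k x → shift (suc k) x ≡ sucMod (shift k x)
  shift-suc k x = begin
      shift (suc k) x     ≡⟨ cong (λ t → shift t x) (+-comm k 1) ⟨
      shift (k + 1) x     ≡⟨ shift-+ k 1 x ⟨
      shift 1 (shift k x) ≡⟨ cong (_mod n) (+-comm _ 1) ⟩
      sucMod (shift k x)  ∎
    where open ≡-Reasoning

  shift-sucMod : ∀ k x → shift k (sucMod x) ≡ sucMod (shift k x)
  shift-sucMod k x = begin
      shift k (sucMod x)  ≡⟨ cong (shift k) (cong (_mod n) (+-comm 1 (toℕ x))) ⟩
      shift k (shift 1 x) ≡⟨ shift-+ 1 k x ⟩
      shift (suc k) x     ≡⟨ shift-suc k x ⟩
      sucMod (shift k x)  ∎
    where open ≡-Reasoning

  module _ {f : Fin n → Fin n} (f-sucMod : ∀ x → f (sucMod x) ≡ sucMod (f x)) where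

    shift-commute : ∀ k x → f (shift k x) ≡ shift k (f x)
    shift-commute zero    x = trans (cong f (shift-0 x)) (sym (shift-0 (f x)))
    shift-commute (suc k) x = begin
        f (shift (suc k) x)     ≡⟨ cong f (shift-suc k x) ⟩
        f (sucMod (shift k x))  ≡⟨ f-sucMod _ ⟩
        sucMod (f (shift k x))  ≡⟨ cong sucMod (shift-commute k x) ⟩
        sucMod (shift k (f x))  ≡⟨ shift-suc k (f x) ⟨
        shift (suc k) (f x)     ∎
      where open ≡-Reasoning

    ≗-shift-origin : ∀ x → shift (toℕ (f origin)) x ≡ f x
    ≗-shift-origin x = begin
        shift (toℕ (f origin)) x   ≡⟨ shift-comm x (f origin) ⟩
        shift (toℕ x) (f origin)   ≡⟨ shift-commute (toℕ x) origin ⟨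
        f (shift (toℕ x) origin)   ≡⟨ cong f (trans (shift-origin (toℕ x)) (toℕ-mod-inverse x)) ⟩
        f x                        ∎
      where open ≡-Reasoning

    Forbidden-map : ∀ {x y z} → Forbidden x y z → Forbidden (f x) (f y) (f z)
    Forbidden-map (i , inj₁ (refl , refl , refl)) =
      f i , inj₁ (refl , refl , f-sucMod i)
    Forbidden-map (i , inj₂ (inj₁ (refl , refl , refl))) =
      f i , inj₂ (inj₁ (refl , f-sucMod i , refl))
    Forbidden-map (i , inj₂ (inj₂ (refl , refl , refl))) =
      f i , inj₂ (inj₂ (f-sucMod i , refl , refl))

    Forbidden-reflect : ∀ {g : Fin n → Fin n} → (∀ x → f (g x) ≡ x) →
                        ∀ {x y z} → Forbidden (g x) (g y) (g z) → Forbidden x y z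
    Forbidden-reflect f∘g≗id {x} {y} {z} forbidden =
      subst₂ (λ u v → Forbidden u v z) (f∘g≗id x) (f∘g≗id y)
        (subst (Forbidden _ _) (f∘g≗id z) (Forbidden-map forbidden))

  Forbidden-diagonal : ∀ {u v : Fin n} → Forbidden u u v → v ≡ sucMod u
  Forbidden-diagonal (i , inj₁ (refl , refl , refl)) = refl
  Forbidden-diagonal (i , inj₂ (inj₁ (refl , i≡i+1 , refl))) = i≡i+1
  Forbidden-diagonal (i , inj₂ (inj₂ (i≡i+1 , refl , refl))) = i≡i+1

  Aut-sucMod : ∀ (σ : Aut n) x → proj₁ σ ⟨$⟩ʳ sucMod x ≡ sucMod (proj₁ σ ⟨$⟩ʳ x)
  Aut-sucMod σ x =
    Forbidden-diagonal (Equivalence.to (proj₂ σ x x (sucMod x)) (x , inj₁ (refl , refl , refl)))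

  rotation : Fin n → Aut n
  rotation a = permutation (shift (toℕ a)) (shift (n ∸ toℕ a)) forth∘back back∘forth
             , λ i j l → mk⇔ (Forbidden-map (shift-sucMod (toℕ a)))
                              (Forbidden-reflect (shift-sucMod (n ∸ toℕ a)) back∘forth)
    where
      a≤n : toℕ a ≤ n
      a≤n = <⇒≤ (toℕ<n a)
      forth∘back : ∀ x → shift (toℕ a) (shift (n ∸ toℕ a) x) ≡ x
      forth∘back = shift-cancel (m∸n+n≡m a≤n)
      back∘forth : ∀ x → shift (n ∸ toℕ a) (shift (toℕ a) x) ≡ x
      back∘forth = shift-cancel (m+[n∸m]≡n a≤n)

  rotation-+ₘ : ∀ a b → rotation (a +ₘ b) ≈ᴬ (rotation a ∙ᴬ rotation b)
  rotation-+ₘ a b x = begin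
      shift (toℕ (a +ₘ b)) x             ≡⟨ cong (λ t → shift t x) (toℕ-mod _) ⟩
      shift ((toℕ a + toℕ b) % n) x      ≡⟨ shift-% _ x ⟩
      shift (toℕ a + toℕ b) x            ≡⟨ cong (λ t → shift t x) (+-comm (toℕ a) _) ⟩
      shift (toℕ b + toℕ a) x            ≡⟨ shift-+ _ _ x ⟨
      shift (toℕ a) (shift (toℕ b) x)    ∎
    where open ≡-Reasoning

  rotation-injective : ∀ a b → rotation a ≈ᴬ rotation b → a ≡ b
  rotation-injective a b ra≈rb = begin
      a                        ≡⟨ toℕ-mod-inverse a ⟨
      toℕ a mod n              ≡⟨ shift-origin (toℕ a) ⟨
      shift (toℕ a) origin     ≡⟨ ra≈rb origin ⟩
      shift (toℕ b) origin     ≡⟨ shift-origin (toℕ b) ⟩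
      toℕ b mod n              ≡⟨ toℕ-mod-inverse b ⟩
      b                        ∎
    where open ≡-Reasoning

  rotation-surjective : ∀ (σ : Aut n) → ∃ λ a → rotation a ≈ᴬ σ
  rotation-surjective σ = proj₁ σ ⟨$⟩ʳ origin , ≗-shift-origin (Aut-sucMod σ)

lemma4 : (n : ℕ) .{{_ : NonZero n}} → ∃ λ (φ : Fin n → Aut n) → IsGroupIsoZn→Aut n φ
lemma4 n = rotation , rotation-+ₘ , rotation-injective , rotation-surjective
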